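{- Let $P=(X,\le)$ be a poset and $\mathcal{M}$ a collection of subsets of $X$ containing all singletons. Then $\sigma_{\mathcal{M}}\subseteq\tau_{\mathcal{M}}$.
   Context: $\mathcal{M}_\vee$ is the set of members of $\mathcal{M}$ having a supremum. $\sigma_{\mathcal{M}}=\{U\subseteq X: U=\uparrow U,\ \forall M\in\mathcal{M}_\vee(\bigvee M\in U\Rightarrow U\cap M\ne\varnothing)\}$. For a net $n=(x_i)_{i\in I}$, $\operatorname{elb}(n)$ is the set of eventual lower bounds of $n$; $n$ $\mathcal{M}$-converges to $x$ if there is $M\in\mathcal{M}_\vee$ with $M\subseteq\operatorname{elb}(n)$ and $x\le\bigvee M$. $\tau_{\mathcal{M}}$ is the topology of all $U$ such that whenever $n$ $\mathcal{M}$-converges to $x\in U$, $n$ is eventually in $U$. -}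

module Defs where

open import Level using (Level; suc; _⊔_)
open import Data.Product using (Σ; ∃; _×_; _,_)
open import Relation.Binary.PropositionalEquality using (_≡_)
open import Relation.Binary.Structures using (IsPartialOrder)

Subset : ∀ {ℓ} → Set ℓ → Set (suc ℓ)
Subset {ℓ} X = X → Set ℓ

record PosetOn {ℓ} (X : Set ℓ) : Set (suc ℓ) where
  field
    _≤_ : X → X → Set ℓ
    isPartialOrder : IsPartialOrder _≡_ _≤_

record Directed {ℓ} (I : Set ℓ) : Set (suc ℓ) where
  field
    _⊑_ : I → I → Set ℓ
    ⊑-refl : ∀ i → i ⊑ i
    ⊑-trans : ∀ {i j k} → i ⊑ j → j ⊑ k → i ⊑ k
    inhabited : I
    upper : ∀ i j → Σ I (λ k → (i ⊑ k) × (j ⊑ k))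

module _ {ℓ} {X : Set ℓ} (P : PosetOn X) where
  open PosetOn P

  IsUpperBound : Subset X → X → Set ℓ
  IsUpperBound M s = ∀ m → M m → m ≤ s

  IsSup : Subset X → X → Set ℓ
  IsSup M s = IsUpperBound M s × (∀ t → IsUpperBound M t → s ≤ t)

  IsUpSet : Subset X → Set ℓ
  IsUpSet U = ∀ x y → U x → x ≤ y → U y

  InSigma : ∀ {ℓ'} → (Subset X → Set ℓ') → Subset X → Set (suc ℓ ⊔ ℓ')
  InSigma 𝓜 U =
    IsUpSet U ×
    (∀ M → 𝓜 M → ∀ s → IsSup M s → U s → Σ X (λ m → M m × U m))

  module _ {I : Set ℓ} (D : Directed I) where
    open Directed D

    EventuallyIn : (I → X) → Subset X → Set ℓ
    EventuallyIn n U = Σ I (λ i₀ → ∀ i → i₀ ⊑ i → U (n i))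

    Elb : (I → X) → Subset X
    Elb n y = Σ I (λ i₀ → ∀ i → i₀ ⊑ i → y ≤ n i)

    MConverges : ∀ {ℓ'} → (Subset X → Set ℓ') → (I → X) → X → Set (suc ℓ ⊔ ℓ')
    MConverges 𝓜 n x =
      Σ (Subset X) (λ M → 𝓜 M × Σ X (λ s → IsSup M s ×
        (∀ y → M y → Elb n y) × (x ≤ s)))

  -- τ_𝓜 : whenever a net (over any directed index set in universe ℓ)
  -- 𝓜-converges to x ∈ U, it is eventually in U
  InTau : ∀ {ℓ'} → (Subset X → Set ℓ') → Subset X → Set (suc ℓ ⊔ ℓ')
  InTau 𝓜 U = ∀ (I : Set ℓ) (D : Directed I) (n : I → X) (x : X) →
    MConverges D 𝓜 n x → U x → EventuallyIn D n U

ContainsSingletons : ∀ {ℓ ℓ'} {X : Set ℓ} → (Subset X → Set ℓ') → Set (ℓ ⊔ ℓ')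
ContainsSingletons {X = X} 𝓜 = ∀ (x : X) → 𝓜 (λ y → y ≡ x)

module Submission where

-- Suppose a net n 𝓜-converges to x ∈ U, witnessed by M ∈ 𝓜_∨ with
-- M ⊆ elb(n) and x ≤ ⋁M.  Since U is an upper set, ⋁M ∈ U, and the defining
-- property of σ_𝓜 yields some m ∈ M ∩ U.  This m is an eventual lower bound
-- of n, i.e. from some index on every n i lies above m, hence in U because U
-- is an upper set again.  The argument does not need that 𝓜 contains
-- the singletons, so that hypothesis is left unused.

open import Defs
open import Data.Product using (Σ; _×_; _,_)

module _ {ℓ} {X : Set ℓ} (P : PosetOn X) where
  open PosetOn P

  upSet-eventually : ∀ {I : Set ℓ} (D : Directed I) (n : I → X) (U : Subset X) →
    IsUpSet P U → ∀ y → Elb P D n y → U y → EventuallyIn P D n U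
  upSet-eventually D n U up y (i₀ , y≤n) Uy =
    i₀ , λ i i₀⊑i → up y (n i) Uy (y≤n i i₀⊑i)

  sigma-meets : ∀ {ℓ'} (𝓜 : Subset X → Set ℓ') (U : Subset X) →
    InSigma P 𝓜 U → ∀ M → 𝓜 M → ∀ s → IsSup P M s →
    ∀ x → x ≤ s → U x → Σ X (λ m → M m × U m)
  sigma-meets 𝓜 U (up , inaccessible) M M∈𝓜 s sup x x≤s Ux =
    inaccessible M M∈𝓜 s sup (up x s Ux x≤s)

lemma3p5 : ∀ {ℓ ℓ'} {X : Set ℓ} (P : PosetOn X) (𝓜 : Subset X → Set ℓ') →
    ContainsSingletons 𝓜 →
    ∀ (U : Subset X) → InSigma P 𝓜 U → InTau P 𝓜 U
lemma3p5 P 𝓜 _ U U∈σ@(up , _) I D n x (M , M∈𝓜 , s , sup , M⊆elb , x≤s) Ux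
  with sigma-meets P 𝓜 U U∈σ M M∈𝓜 s sup x x≤s Ux
... | m , Mm , Um = upSet-eventually P D n U up m (M⊆elb m Mm) Um
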